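{- Let $m$ be a positive integer and consider the equation \[ \cos \tfrac{2\pi j}{m} + \cos \tfrac{2\pi \ell}{m} = 2 \cos \tfrac{2\pi j}{m} \cos \tfrac{2\pi \ell}{m} \] in the unknowns $j,\ell\in\{0,\dots,m-1\}$. If $4$ divides $m$, the equation has at least $4$ solutions $(j,\ell)\neq(0,0)$. If $5$ divides $m$, the equation has at least $8$ solutions $(j,\ell)\ne(0,0)$.
   Context: The solution $(j,\ell)=(0,0)$ is called the trivial solution; "non-trivial" means $(j,\ell)\neq(0,0)$. -}

module Defs where

open import Level using (Level; _⊔_)
open import Algebra.Bundles using (CommutativeRing; Semiring)
import Algebra.Definitions.RawSemiring as RS
open import Data.Nat using (ℕ; zero; suc; _∸_; _<_; _≤_)
open import Data.Fin using (Fin; toℕ)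
open import Data.Product using (_×_; Σ; _,_)
open import Data.Sum using (_⊎_)
open import Data.List using (List; length)
open import Data.List.Relation.Unary.All using (All)
open import Data.List.Relation.Unary.Unique.Propositional using (Unique)
open import Relation.Nullary using (¬_)
open import Relation.Binary.PropositionalEquality using (_≡_)

module _ {c ℓ : Level} (R : CommutativeRing c ℓ) where
  open CommutativeRing R
  open RS (Semiring.rawSemiring semiring) using (_^_) renaming (_×_ to _·ℕ_)

  IsIntegralDomain : Set (c ⊔ ℓ)
  IsIntegralDomain = (¬ (1# ≈ 0#)) × (∀ x y → x * y ≈ 0# → (x ≈ 0#) ⊎ (y ≈ 0#))

  HasCharZero : Set ℓ
  HasCharZero = ∀ (n : ℕ) → ¬ ((suc n ·ℕ 1#) ≈ 0#)

  IsPrimitiveRoot : ℕ → Carrier → Set ℓ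
  IsPrimitiveRoot m ζ = ((ζ ^ m) ≈ 1#) × (∀ k → 0 < k → k < m → ¬ ((ζ ^ k) ≈ 1#))

  -- twoCos m ζ j = ζ^j + ζ^(-j) ; for ζ = exp(2πi/m) this is 2 cos(2πj/m)
  twoCos : (m : ℕ) → Carrier → Fin m → Carrier
  twoCos m ζ j = (ζ ^ toℕ j) + (ζ ^ (m ∸ toℕ j))

  -- cos(2πj/m) + cos(2πl/m) = 2 cos(2πj/m) cos(2πl/m), multiplied by 2
  IsSolution : (m : ℕ) → Carrier → Fin m × Fin m → Set ℓ
  IsSolution m ζ (j , l) = (twoCos m ζ j + twoCos m ζ l) ≈ (twoCos m ζ j * twoCos m ζ l)

  NonTrivial : {m : ℕ} → Fin m × Fin m → Set
  NonTrivial (j , l) = ¬ ((toℕ j ≡ 0) × (toℕ l ≡ 0))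

  AtLeastNontrivialSolutions : (m : ℕ) → Carrier → ℕ → Set ℓ
  AtLeastNontrivialSolutions m ζ k =
    Σ (List (Fin m × Fin m)) λ xs →
      Unique xs × (k ≤ length xs) × All (λ p → NonTrivial p × IsSolution m ζ p) xs

-- If ζ is a primitive m-th root of unity and m = q·n, then j ↦ q·j maps Fin n
-- into Fin m and turns twoCos m ζ into twoCos n (ζ^q), where ζ^q is a
-- primitive n-th root of unity; so solutions for n lift injectively to
-- solutions for m.  For a primitive 4th root x we have x² = -1, hence
-- twoCos 4 x j = 0 for j = 1, 3, and any two zeros satisfy u + v = u·v.  For a
-- 5th root of unity x, the numbers a = x + x⁴ and b = x² + x³ satisfy
-- a·b = x³ + x⁴ + x⁶ + x⁷ = a + b, giving the pairs {1,4}×{2,3} and {2,3}×{1,4}.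
module Submission where

open import Defs
open import Level using (Level)
open import Algebra.Bundles using (CommutativeRing)
open import Data.Nat using (ℕ; _<_)
open import Data.Nat.Divisibility using (_∣_)
open import Data.Product using (_×_)

open import Algebra.Bundles using (Semiring)
import Algebra.Definitions.RawSemiring as RawSemiringDefinitions
import Algebra.Properties.Group as GroupProperties
import Algebra.Properties.Semiring.Exp as ExpProperties
import Algebra.Solver.Ring.NaturalCoefficients.Default as NaturalSolver
open import Data.Empty using (⊥-elim)
open import Data.Fin using (Fin; toℕ; fromℕ<; #_; _≟_)
open import Data.Fin.Properties using (toℕ<n; toℕ-fromℕ<; toℕ-injective)
open import Data.List using (List; []; _∷_; map)
open import Data.List.Properties using (length-map)
open import Data.List.Relation.Unary.All as All using ([]; _∷_)
import Data.List.Relation.Unary.All.Properties as AllProperties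
import Data.List.Relation.Unary.Unique.Propositional.Properties as Unique
open import Data.List.Relation.Unary.Unique.DecPropositional using (unique?)
open import Data.Nat using (NonZero; >-nonZero; _∸_; z<s; s<s) renaming (_*_ to _*ℕ_)
open import Data.Nat.Divisibility using (divides-refl)
import Data.Nat.Properties as ℕₚ
open import Data.Product using (_,_; proj₁; proj₂)
open import Data.Product.Properties using (≡-dec)
open import Data.Sum using (inj₁; inj₂)
open import Function using (_∘_)
open import Relation.Nullary.Decidable using (toWitness)
open import Relation.Binary.PropositionalEquality as ≡ using (_≡_; _≢_)
import Relation.Binary.Reasoning.Setoid as SetoidReasoning

module _ {c ℓ : Level} (R : CommutativeRing c ℓ) where
  open CommutativeRing R
  open RawSemiringDefinitions (Semiring.rawSemiring semiring) using (_^_)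
  open ExpProperties semiring using (^-assocʳ)
  open GroupProperties +-group using (x∙y⁻¹≈ε⇒x≈y)
  open NaturalSolver commutativeSemiring using (solve; _:+_; _:*_; _:^_; con; _:=_)
  open SetoidReasoning setoid

  +≈*-resp-≈ : {u v u′ v′ : Carrier} → u ≈ u′ → v ≈ v′ → u + v ≈ u * v → u′ + v′ ≈ u′ * v′
  +≈*-resp-≈ {u} {v} {u′} {v′} u≈u′ v≈v′ u+v≈uv = begin
    u′ + v′ ≈⟨ +-cong u≈u′ v≈v′ ⟨
    u + v   ≈⟨ u+v≈uv ⟩
    u * v   ≈⟨ *-cong u≈u′ v≈v′ ⟩
    u′ * v′ ∎

  scale : (q : ℕ) .{{_ : NonZero q}} {n : ℕ} → Fin n → Fin (q *ℕ n)
  scale q j = fromℕ< (ℕₚ.*-monoʳ-< q (toℕ<n j))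

  module _ (q : ℕ) .{{_ : NonZero q}} {n : ℕ} where

    toℕ-scale : (j : Fin n) → toℕ (scale q j) ≡ q *ℕ toℕ j
    toℕ-scale j = toℕ-fromℕ< (ℕₚ.*-monoʳ-< q (toℕ<n j))

    scale-injective : {i j : Fin n} → scale q i ≡ scale q j → i ≡ j
    scale-injective {i} {j} eq = toℕ-injective (ℕₚ.*-cancelˡ-≡ (toℕ i) (toℕ j) q
      (≡.trans (≡.sym (toℕ-scale i)) (≡.trans (≡.cong toℕ eq) (toℕ-scale j))))

    twoCos-scale : (ζ : Carrier) (j : Fin n) → twoCos R (q *ℕ n) ζ (scale q j) ≈ twoCos R n (ζ ^ q) j
    twoCos-scale ζ j = begin
      ζ ^ toℕ (scale q j) + ζ ^ (q *ℕ n ∸ toℕ (scale q j))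
        ≡⟨ ≡.cong (λ k → ζ ^ k + ζ ^ (q *ℕ n ∸ k)) (toℕ-scale j) ⟩
      ζ ^ (q *ℕ toℕ j) + ζ ^ (q *ℕ n ∸ q *ℕ toℕ j)
        ≡⟨ ≡.cong (λ k → ζ ^ (q *ℕ toℕ j) + ζ ^ k) (ℕₚ.*-distribˡ-∸ q n (toℕ j)) ⟨
      ζ ^ (q *ℕ toℕ j) + ζ ^ (q *ℕ (n ∸ toℕ j))
        ≈⟨ +-cong (^-assocʳ ζ q (toℕ j)) (^-assocʳ ζ q (n ∸ toℕ j)) ⟨
      (ζ ^ q) ^ toℕ j + (ζ ^ q) ^ (n ∸ toℕ j) ∎

    toℕ-scale≡0 : {j : Fin n} → toℕ (scale q j) ≡ 0 → toℕ j ≡ 0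
    toℕ-scale≡0 {j} eq = ℕₚ.m*n≡0⇒m≡0 (toℕ j) q
      (≡.trans (ℕₚ.*-comm (toℕ j) q) (≡.trans (≡.sym (toℕ-scale j)) eq))

    scale² : Fin n × Fin n → Fin (q *ℕ n) × Fin (q *ℕ n)
    scale² (j , l) = scale q j , scale q l

    scale²-injective : {p p′ : Fin n × Fin n} → scale² p ≡ scale² p′ → p ≡ p′
    scale²-injective eq = ≡.cong₂ _,_ (scale-injective (≡.cong proj₁ eq)) (scale-injective (≡.cong proj₂ eq))

    scale²-nonTrivial : {p : Fin n × Fin n} → NonTrivial R p → NonTrivial R (scale² p)
    scale²-nonTrivial nt (j≡0 , l≡0) = nt (toℕ-scale≡0 j≡0 , toℕ-scale≡0 l≡0)

    scale²-isSolution : (ζ : Carrier) {p : Fin n × Fin n} → IsSolution R n (ζ ^ q) p → IsSolution R (q *ℕ n) ζ (scale² p)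
    scale²-isSolution ζ {j , l} = +≈*-resp-≈ (sym (twoCos-scale ζ j)) (sym (twoCos-scale ζ l))

    solutions-scale : (ζ : Carrier) {k : ℕ} → AtLeastNontrivialSolutions R n (ζ ^ q) k → AtLeastNontrivialSolutions R (q *ℕ n) ζ k
    solutions-scale ζ {k} (ps , unique , k≤|ps| , sols) =
      map scale² ps ,
      Unique.map⁺ scale²-injective unique ,
      ℕₚ.≤-trans k≤|ps| (ℕₚ.≤-reflexive (≡.sym (length-map scale² ps))) ,
      AllProperties.map⁺ (All.map (λ (nt , sol) → scale²-nonTrivial nt , scale²-isSolution ζ sol) sols)

    ^-isPrimitiveRoot : {ζ : Carrier} → IsPrimitiveRoot R (q *ℕ n) ζ → IsPrimitiveRoot R n (ζ ^ q)
    ^-isPrimitiveRoot {ζ} (ζ^qn≈1 , minimal) =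
      trans (^-assocʳ ζ q n) ζ^qn≈1 ,
      λ k 0<k k<n ζ^q^k≈1 → minimal (q *ℕ k)
        (≡.subst (_< q *ℕ k) (ℕₚ.*-zeroʳ q) (ℕₚ.*-monoʳ-< q 0<k))
        (ℕₚ.*-monoʳ-< q k<n)
        (trans (sym (^-assocʳ ζ q k)) ζ^q^k≈1)

  solutions-from-divisor : {m n k : ℕ} {ζ : Carrier} → 0 < m → n ∣ m → IsPrimitiveRoot R m ζ →
                         ((x : Carrier) → IsPrimitiveRoot R n x → AtLeastNontrivialSolutions R n x k) →
                         AtLeastNontrivialSolutions R m ζ k
  solutions-from-divisor {ζ = ζ} 0<m (divides-refl q) ζ-primitive solutions =
    solutions-scale q ζ (solutions (ζ ^ q) (^-isPrimitiveRoot q ζ-primitive))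
    where instance _ = ℕₚ.m*n≢0⇒m≢0 q {{>-nonZero 0<m}}

  nontrivialSolution : {n : ℕ} {x u v : Carrier} (j l : Fin n) → toℕ j ≢ 0 →
                       twoCos R n x j ≈ u → twoCos R n x l ≈ v → u + v ≈ u * v →
                       NonTrivial R (j , l) × IsSolution R n x (j , l)
  nontrivialSolution _ _ j≢0 tj≈u tl≈v u+v≈uv = j≢0 ∘ proj₁ , +≈*-resp-≈ (sym tj≈u) (sym tl≈v) u+v≈uv

  module _ {x : Carrier} where

    primitiveFourthRoot⇒x²+1≈0 : IsIntegralDomain R → IsPrimitiveRoot R 4 x → x ^ 2 + 1# ≈ 0#
    primitiveFourthRoot⇒x²+1≈0 (_ , noZeroDivisors) (x⁴≈1 , minimal)
      with noZeroDivisors (x ^ 2 + - 1#) (x ^ 2 + 1#) product≈0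
      where
      product≈0 : (x ^ 2 + - 1#) * (x ^ 2 + 1#) ≈ 0#
      product≈0 = begin
        (x ^ 2 + - 1#) * (x ^ 2 + 1#)
          ≈⟨ solve 2 (λ x n → (x :^ 2 :+ n) :* (x :^ 2 :+ con 1) := (x :^ 4 :+ n) :+ x :^ 2 :* (n :+ con 1)) refl x (- 1#) ⟩
        (x ^ 4 + - 1#) + x ^ 2 * (- 1# + 1#) ≈⟨ +-cong (+-congʳ x⁴≈1) (*-congˡ (-‿inverseˡ 1#)) ⟩
        (1# + - 1#) + x ^ 2 * 0#             ≈⟨ +-cong (-‿inverseʳ 1#) (zeroʳ _) ⟩
        0# + 0#                              ≈⟨ +-identityˡ 0# ⟩
        0#                                   ∎
    ... | inj₁ x²-1≈0 = ⊥-elim (minimal 2 z<s (s<s (s<s z<s)) (x∙y⁻¹≈ε⇒x≈y _ _ x²-1≈0))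
    ... | inj₂ x²+1≈0 = x²+1≈0

    primitiveFourthRoot⇒twoCos₁≈0 : IsIntegralDomain R → IsPrimitiveRoot R 4 x → twoCos R 4 x (# 1) ≈ 0#
    primitiveFourthRoot⇒twoCos₁≈0 domain x-primitive = begin
      x ^ 1 + x ^ 3     ≈⟨ solve 1 (λ x → x :^ 1 :+ x :^ 3 := x :* (x :^ 2 :+ con 1)) refl x ⟩
      x * (x ^ 2 + 1#)  ≈⟨ *-congˡ (primitiveFourthRoot⇒x²+1≈0 domain x-primitive) ⟩
      x * 0#            ≈⟨ zeroʳ x ⟩
      0#                ∎

    primitiveFourthRoot-solutions : IsIntegralDomain R → IsPrimitiveRoot R 4 x → AtLeastNontrivialSolutions R 4 x 4
    primitiveFourthRoot-solutions domain x-primitive =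
      ps , toWitness {a? = unique? (≡-dec _≟_ _≟_) ps} _ , ℕₚ.≤-refl ,
      nontrivialSolution {4} (# 1) (# 1) (λ ()) t₁ t₁ 0+0≈0*0 ∷
      nontrivialSolution {4} (# 1) (# 3) (λ ()) t₁ t₃ 0+0≈0*0 ∷
      nontrivialSolution {4} (# 3) (# 1) (λ ()) t₃ t₁ 0+0≈0*0 ∷
      nontrivialSolution {4} (# 3) (# 3) (λ ()) t₃ t₃ 0+0≈0*0 ∷ []
      where
      ps : List (Fin 4 × Fin 4)
      ps = (# 1 , # 1) ∷ (# 1 , # 3) ∷ (# 3 , # 1) ∷ (# 3 , # 3) ∷ []
      t₁ : twoCos R 4 x (# 1) ≈ 0#
      t₁ = primitiveFourthRoot⇒twoCos₁≈0 domain x-primitive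
      t₃ : twoCos R 4 x (# 3) ≈ 0#
      t₃ = trans (+-comm _ _) t₁
      0+0≈0*0 : 0# + 0# ≈ 0# * 0#
      0+0≈0*0 = trans (+-identityˡ 0#) (sym (zeroˡ 0#))

    fifthRoot⇒sum≈product : x ^ 5 ≈ 1# → (x ^ 1 + x ^ 4) + (x ^ 2 + x ^ 3) ≈ (x ^ 1 + x ^ 4) * (x ^ 2 + x ^ 3)
    fifthRoot⇒sum≈product x⁵≈1 = sym (begin
      (x ^ 1 + x ^ 4) * (x ^ 2 + x ^ 3)
        ≈⟨ solve 1 (λ x → (x :^ 1 :+ x :^ 4) :* (x :^ 2 :+ x :^ 3) := x :^ 5 :* (x :+ x :^ 2) :+ (x :^ 3 :+ x :^ 4)) refl x ⟩
      x ^ 5 * (x + x ^ 2) + (x ^ 3 + x ^ 4)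
        ≈⟨ +-congʳ (*-congʳ x⁵≈1) ⟩
      1# * (x + x ^ 2) + (x ^ 3 + x ^ 4)
        ≈⟨ solve 1 (λ x → con 1 :* (x :+ x :^ 2) :+ (x :^ 3 :+ x :^ 4) := (x :^ 1 :+ x :^ 4) :+ (x :^ 2 :+ x :^ 3)) refl x ⟩
      (x ^ 1 + x ^ 4) + (x ^ 2 + x ^ 3) ∎)

    fifthRoot-solutions : x ^ 5 ≈ 1# → AtLeastNontrivialSolutions R 5 x 8
    fifthRoot-solutions x⁵≈1 =
      ps , toWitness {a? = unique? (≡-dec _≟_ _≟_) ps} _ , ℕₚ.≤-refl ,
      nontrivialSolution {5} (# 1) (# 2) (λ ()) t₁ t₂ a+b≈ab ∷
      nontrivialSolution {5} (# 1) (# 3) (λ ()) t₁ t₃ a+b≈ab ∷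
      nontrivialSolution {5} (# 4) (# 2) (λ ()) t₄ t₂ a+b≈ab ∷
      nontrivialSolution {5} (# 4) (# 3) (λ ()) t₄ t₃ a+b≈ab ∷
      nontrivialSolution {5} (# 2) (# 1) (λ ()) t₂ t₁ b+a≈ba ∷
      nontrivialSolution {5} (# 3) (# 1) (λ ()) t₃ t₁ b+a≈ba ∷
      nontrivialSolution {5} (# 2) (# 4) (λ ()) t₂ t₄ b+a≈ba ∷
      nontrivialSolution {5} (# 3) (# 4) (λ ()) t₃ t₄ b+a≈ba ∷ []
      where
      ps : List (Fin 5 × Fin 5)
      ps = (# 1 , # 2) ∷ (# 1 , # 3) ∷ (# 4 , # 2) ∷ (# 4 , # 3)
         ∷ (# 2 , # 1) ∷ (# 3 , # 1) ∷ (# 2 , # 4) ∷ (# 3 , # 4) ∷ []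
      a b : Carrier
      a = x ^ 1 + x ^ 4
      b = x ^ 2 + x ^ 3
      t₁ : twoCos R 5 x (# 1) ≈ a
      t₁ = refl
      t₄ : twoCos R 5 x (# 4) ≈ a
      t₄ = +-comm _ _
      t₂ : twoCos R 5 x (# 2) ≈ b
      t₂ = refl
      t₃ : twoCos R 5 x (# 3) ≈ b
      t₃ = +-comm _ _
      a+b≈ab : a + b ≈ a * b
      a+b≈ab = fifthRoot⇒sum≈product x⁵≈1
      b+a≈ba : b + a ≈ b * a
      b+a≈ba = trans (+-comm b a) (trans a+b≈ab (*-comm a b))

lemmaA1 : {c ℓ : Level} (R : CommutativeRing c ℓ) → IsIntegralDomain R → HasCharZero R →
    (m : ℕ) → 0 < m → (ζ : CommutativeRing.Carrier R) → IsPrimitiveRoot R m ζ →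
    ((4 ∣ m → AtLeastNontrivialSolutions R m ζ 4) × (5 ∣ m → AtLeastNontrivialSolutions R m ζ 8))
lemmaA1 R domain _ m 0<m ζ ζ-primitive =
  (λ 4∣m → solutions-from-divisor R 0<m 4∣m ζ-primitive (λ _ → primitiveFourthRoot-solutions R domain)) ,
  (λ 5∣m → solutions-from-divisor R 0<m 5∣m ζ-primitive (λ _ → fifthRoot-solutions R ∘ proj₁))
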